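{- The list $x_1,x_2,\dots,x_{\ell mn}$ is an ordering of the vertices of $K_\ell\square K_m\square K_n$, i.e. it is in one-to-one correspondence with $V(K_\ell\square K_m\square K_n)$.
   Context: Let $\ell,m,n\geq 2$ be integers, $L=\mathrm{lcm}(\ell,m,n)$ and $\lambda=\frac{n\cdot\mathrm{lcm}(\ell,m)}{L}$. Write $V(K_\ell)=\{u_1,\dots,u_\ell\}$, $V(K_m)=\{v_1,\dots,v_m\}$, $V(K_n)=\{w_1,\dots,w_n\}$, so vertices of $K_\ell\square K_m\square K_n$ are triples $(u_a,v_b,w_c)$. Let $\rho=(u_1\,u_2\,\cdots\,u_\ell)$, $\sigma=(v_1\,v_2\,\cdots\,v_m)$, $\tau=(w_1\,w_2\,\cdots\,w_n)$ be the cyclic permutations of the respective vertex sets. Define $L\times 3$ matrices $A^{(k)}=[\mathbf{c}^{(k)}\ \mathbf{d}^{(k)}\ \mathbf{e}^{(k)}]$ (columns) for $k=1,\dots,\frac{\ell mn}{L}$ as follows: row $r$ ($r=1,\dots,L$) of $A^{(1)}$ is $(\rho^{r-1}(u_1),\sigma^{r-1}(v_1),\tau^{r-1}(w_1))$; for $k>1$, $\mathbf{c}^{(k)}=\mathbf{c}^{(1)}$, and if $k\equiv 1\pmod{\lambda}$ then $\mathbf{d}^{(k)}=\sigma(\mathbf{d}^{(k-1)})$, $\mathbf{e}^{(k)}=\mathbf{e}^{(k-1)}$, while otherwise $\mathbf{d}^{(k)}=\mathbf{d}^{(k-1)}$, $\mathbf{e}^{(k)}=\tau(\mathbf{e}^{(k-1)})$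 (permutations applied entrywise). Each row is regarded as a vertex of $K_\ell\square K_m\square K_n$. For $h\in\{1,\dots,\ell mn\}$ write $h=Lb+c$ with $c\in\{1,\dots,L\}$, and let $x_h$ be the $c$-th row of $A^{(b+1)}$. -}

module Defs where

open import Data.Nat.Base
open import Agda.Builtin.Unit
open import Function.Base using (it)
open import Data.Nat.Properties using (m*n≢0; m*n≢0⇒n≢0)
open import Data.Nat.DivMod using (_mod_)
open import Data.Nat.LCM using (lcm; gcd*lcm)
open import Data.Nat.GCD using (gcd)
open import Data.Nat.Divisibility using (_∣?_)
open import Data.Fin.Base using (Fin; toℕ)
open import Data.Product using (_×_; _,_)
open import Relation.Nullary using (yes; no)
open import Relation.Binary.PropositionalEquality using (subst; sym)

-- Vertices of K_ℓ □ K_m □ K_n : triples (u_a , v_b , w_c), 0-indexed: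
-- u_{a+1} is represented by a : Fin ℓ, etc.
Vertex : ℕ → ℕ → ℕ → Set
Vertex ℓ m n = Fin ℓ × Fin m × Fin n

cyc : (k : ℕ) .{{_ : NonZero k}} → Fin k → Fin k
cyc k i = suc (toℕ i) mod k

iter : {A : Set} → (A → A) → ℕ → A → A
iter f zero    x = x
iter f (suc j) x = f (iter f j x)

first : (k : ℕ) .{{_ : NonZero k}} → Fin k
first k = 0 mod k

lcm-nonZero : ∀ a b .{{_ : NonZero a}} .{{_ : NonZero b}} → NonZero (lcm a b)
lcm-nonZero a b = m*n≢0⇒n≢0 (gcd a b) {{subst NonZero (sym (gcd*lcm a b)) (m*n≢0 a b)}}

module Construction (ℓ m n : ℕ) .{{_ : NonZero ℓ}} .{{_ : NonZero m}} .{{_ : NonZero n}} where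

  L : ℕ
  L = lcm ℓ (lcm m n)

  instance
    L-nonZero : NonZero L
    L-nonZero = lcm-nonZero ℓ (lcm m n) {{it}} {{lcm-nonZero m n}}

  lam : ℕ
  lam = (n * lcm ℓ m) / L

  ρ : Fin ℓ → Fin ℓ
  ρ = cyc ℓ
  σ : Fin m → Fin m
  σ = cyc m
  τ : Fin n → Fin n
  τ = cyc n

  -- Columns of A^(k), indexed by k ≥ 1; a column is a function of the row
  -- index, rows 0-indexed (row r+1 in the paper is argument r here).
  -- The value at k = 0 is never used.
  colC : ℕ → ℕ → Fin ℓ
  colC k r = iter ρ r (first ℓ)

  colDE : ℕ → (ℕ → Fin m) × (ℕ → Fin n)
  colDE zero          = (λ r → iter σ r (first m)) , (λ r → iter τ r (first n))
  colDE (suc zero)    = (λ r → iter σ r (first m)) , (λ r → iter τ r (first n))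
  colDE (suc (suc j)) with colDE (suc j) | lam ∣? suc j
  -- k = suc (suc j); k ≡ 1 (mod λ)  ⇔  λ ∣ k - 1 = suc j
  ... | d , e | yes _ = (λ r → σ (d r)) , e
  ... | d , e | no  _ = d , (λ r → τ (e r))

  row : ℕ → ℕ → Vertex ℓ m n
  row k r with colDE k
  ... | d , e = colC k r , d r , e r

  -- x_{h+1} for h = 0,…,ℓmn-1 : writing h+1 = L b + c with c ∈ {1,…,L},
  -- b = h / L and c - 1 = h % L.
  x : ℕ → Vertex ℓ m n
  x h = row (suc (h / L)) (h % L)

xs : (ℓ m n : ℕ) .{{_ : NonZero ℓ}} .{{_ : NonZero m}} .{{_ : NonZero n}} →
     Fin (ℓ * m * n) → Vertex ℓ m n
xs ℓ m n i = Construction.x ℓ m n (toℕ i)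

-- Row r (counted from 0) of A^(j+1) is the vertex (r mod ℓ , r + s mod m , r + t mod n),
-- where s = ⌊j/λ⌋ is the number of σ-steps and t = j − s the number of τ-steps taken
-- to reach A^(j+1). Since ℓmn/L = gcd(ℓ,m)·λ, the index h = jL + r ranges over
-- r < L and j < gcd(ℓ,m)·λ, so s < gcd(ℓ,m). If two such rows coincide, the first two
-- coordinates give s ≡ s' mod gcd(ℓ,m), hence s = s', and then r ≡ r' mod lcm(ℓ,m),
-- in particular mod λ (which divides both lcm(ℓ,m) and n). The third coordinate then
-- gives t ≡ t' mod λ, so j ≡ j' mod λ with equal quotients s = s', hence j = j', and
-- finally r ≡ r' mod ℓ, m and n gives r = r'. An injection between two sets of size
-- ℓmn is a bijection.
module Submission where

open import Defs
open import Data.Nat.Base using (ℕ; _≤_; NonZero)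
open import Function.Definitions using (Bijective)
open import Relation.Binary.PropositionalEquality using (_≡_)

open import Data.Nat.Base using (zero; suc; _+_; _*_; _<_; _/_; _%_)
import Data.Nat.Properties as ℕ
open import Data.Nat.DivMod hiding (_mod_)
open import Data.Nat.Divisibility as ℕ∣ using (_∣_; _∣?_; >⇒∤)
open import Data.Nat.LCM using (lcm; lcm-least; m∣lcm[m,n]; n∣lcm[m,n]; gcd*lcm)
open import Data.Nat.GCD using (gcd; gcd[m,n]∣m; gcd[m,n]∣n)
open import Data.Integer.Base as ℤ using (ℤ; +_)
import Data.Integer.Properties as ℤ
import Data.Integer.Divisibility.Signed as ℤ∣
import Data.Integer.Tactic.RingSolver as ℤ-Solver
open import Data.Fin.Base using (Fin; toℕ; combine; punchOut)
import Data.Fin.Properties as Fin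
open import Data.Product using (_×_; _,_; proj₁; proj₂; ∃)
open import Function.Definitions using (Injective; Surjective)
open import Relation.Binary.PropositionalEquality
  using (refl; sym; trans; cong; cong₂; subst; subst₂; _≢_; module ≡-Reasoning)
open import Relation.Nullary using (¬_; yes; no; contradiction)

private variable a b c d k j : ℕ

-- Congruence of naturals, via signed divisibility of the difference so that both
-- sides can be cancelled from sums.
infix 4 _≡_mod_
record _≡_mod_ (a b k : ℕ) : Set where
  constructor divides-difference
  field k∣a-b : + k ℤ∣.∣ + a ℤ.- + b

[a+c]-[b+d]≡[a-b]+[c-d] : ∀ (a b c d : ℤ) → (a ℤ.+ c) ℤ.- (b ℤ.+ d) ≡ (a ℤ.- b) ℤ.+ (c ℤ.- d)
[a+c]-[b+d]≡[a-b]+[c-d] = ℤ-Solver.solve-∀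

pos-[a+c]-[b+d] : ∀ a b c d → + (a + c) ℤ.- + (b + d) ≡ (+ a ℤ.- + b) ℤ.+ (+ c ℤ.- + d)
pos-[a+c]-[b+d] a b c d = trans (cong₂ ℤ._-_ (ℤ.pos-+ a c) (ℤ.pos-+ b d))
                                ([a+c]-[b+d]≡[a-b]+[c-d] (+ a) (+ b) (+ c) (+ d))

≡⇒≡mod : a ≡ b → a ≡ b mod k
≡⇒≡mod {a} {k = k} refl =
  divides-difference (ℤ∣.divides (+ 0) (trans (ℤ.+-inverseʳ (+ a)) (sym (ℤ.*-zeroˡ (+ k)))))

≡mod-+ : a ≡ b mod k → c ≡ d mod k → a + c ≡ b + d mod k
≡mod-+ {a} {b} {k} {c} {d} (divides-difference a≡b) (divides-difference c≡d) =
  divides-difference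
  (subst (+ k ℤ∣.∣_) (sym (pos-[a+c]-[b+d] a b c d)) (ℤ∣.∣m∣n⇒∣m+n a≡b c≡d))

≡mod-cancelˡ-+ : a ≡ b mod k → a + c ≡ b + d mod k → c ≡ d mod k
≡mod-cancelˡ-+ {a} {b} {k} {c} {d} (divides-difference a≡b) (divides-difference a+c≡b+d) =
  divides-difference
  (ℤ∣.∣m+n∣m⇒∣n (subst (+ k ℤ∣.∣_) (pos-[a+c]-[b+d] a b c d) a+c≡b+d) a≡b)

≡mod-cancelʳ-+ : c ≡ d mod k → a + c ≡ b + d mod k → a ≡ b mod k
≡mod-cancelʳ-+ {c} {d} {k} {a} {b} (divides-difference c≡d) (divides-difference a+c≡b+d) =
  divides-difference
  (ℤ∣.∣m+n∣n⇒∣m (subst (+ k ℤ∣.∣_) (pos-[a+c]-[b+d] a b c d) a+c≡b+d) c≡d)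

≡mod-∣ : d ∣ k → a ≡ b mod k → a ≡ b mod d
≡mod-∣ d∣k (divides-difference a≡b) =
  divides-difference (ℤ∣.∣ᵤ⇒∣ (ℕ∣.∣-trans d∣k (ℤ∣.∣⇒∣ᵤ a≡b)))

≡mod-lcm : a ≡ b mod k → a ≡ b mod j → a ≡ b mod lcm k j
≡mod-lcm (divides-difference a≡b[k]) (divides-difference a≡b[j]) =
  divides-difference (ℤ∣.∣ᵤ⇒∣ (lcm-least (ℤ∣.∣⇒∣ᵤ a≡b[k]) (ℤ∣.∣⇒∣ᵤ a≡b[j])))

m*n≡o*n-mod-n : ∀ m o n → m * n ≡ o * n mod n
m*n≡o*n-mod-n m o n = divides-difference
  (ℤ∣.∣m∣n⇒∣m-n {m = + (m * n)} {n = + (o * n)}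
    (ℤ∣.∣ᵤ⇒∣ (ℕ∣.n∣m*n m)) (ℤ∣.∣ᵤ⇒∣ (ℕ∣.n∣m*n o)))

%≡%⇒≡mod : ∀ a b k .{{_ : NonZero k}} → a % k ≡ b % k → a ≡ b mod k
%≡%⇒≡mod a b k eq =
  subst₂ (λ u v → u ≡ v mod k) (sym (m≡m%n+[m/n]*n a k)) (sym (m≡m%n+[m/n]*n b k))
    (≡mod-+ (≡⇒≡mod eq) (m*n≡o*n-mod-n (a / k) (b / k) k))

∣∧<⇒≡0 : k ∣ a → a < k → a ≡ 0
∣∧<⇒≡0 {a = zero}  _   _   = refl
∣∧<⇒≡0 {a = suc _} k∣a a<k = contradiction k∣a (>⇒∤ a<k)

≡mod⇒≡ : a < k → b < k → a ≡ b mod k → a ≡ b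
≡mod⇒≡ {a} {k} {b} a<k b<k (divides-difference a≡b) =
  ℤ.+-injective (ℤ.i-j≡0⇒i≡j _ _ (ℤ.∣i∣≡0⇒i≡0 (∣∧<⇒≡0 (ℤ∣.∣⇒∣ᵤ a≡b) ∣a-b∣<k)))
  where
  ∣a-b∣<k : ℤ.∣ + a ℤ.- + b ∣ < k
  ∣a-b∣<k = subst (_< k) (cong ℤ.∣_∣ (sym (ℤ.m-n≡m⊖n a b)))
              (ℕ.≤-<-trans (ℤ.∣m⊝n∣≤m⊔n a b) (ℕ.⊔-pres-<m a<k b<k))

≡mod∧/≡/⇒≡ : ∀ a b k .{{_ : NonZero k}} → a ≡ b mod k → a / k ≡ b / k → a ≡ b
≡mod∧/≡/⇒≡ a b k a≡b a/k≡b/k = begin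
  a                   ≡⟨ m≡m%n+[m/n]*n a k ⟩
  a % k + a / k * k   ≡⟨ cong₂ (λ u v → u + v * k) %-equal a/k≡b/k ⟩
  b % k + b / k * k   ≡⟨ sym (m≡m%n+[m/n]*n b k) ⟩
  b                   ∎
  where
  open ≡-Reasoning
  %-equal : a % k ≡ b % k
  %-equal = ≡mod⇒≡ (m%n<n a k) (m%n<n b k)
    (≡mod-cancelʳ-+ (m*n≡o*n-mod-n (a / k) (b / k) k)
      (subst₂ (λ u v → u ≡ v mod k) (m≡m%n+[m/n]*n a k) (m≡m%n+[m/n]*n b k) a≡b))

module _ (j k : ℕ) .{{_ : NonZero k}} where
  private
    suc-j≡ : suc j ≡ j / k * k + suc (j % k)
    suc-j≡ = trans (cong suc (trans (m≡m%n+[m/n]*n j k) (ℕ.+-comm (j % k) _)))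
                   (sym (ℕ.+-suc _ (j % k)))

    suc-/ : suc j / k ≡ j / k + suc (j % k) / k
    suc-/ = begin
      suc j / k                          ≡⟨ /-congˡ suc-j≡ ⟩
      (j / k * k + suc (j % k)) / k      ≡⟨ +-distrib-/-∣ˡ (suc (j % k)) (ℕ∣.n∣m*n (j / k)) ⟩
      j / k * k / k + suc (j % k) / k    ≡⟨ cong (_+ suc (j % k) / k) (m*n/n≡m (j / k) k) ⟩
      j / k + suc (j % k) / k            ∎
      where open ≡-Reasoning

  suc-/-∣ : k ∣ suc j → suc j / k ≡ suc (j / k)
  suc-/-∣ k∣suc-j = begin
    suc j / k                ≡⟨ suc-/ ⟩
    j / k + suc (j % k) / k  ≡⟨ cong (λ u → j / k + u / k) suc[j%k]≡k ⟩
    j / k + k / k            ≡⟨ cong (_+_ (j / k)) (n/n≡1 k) ⟩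
    j / k + 1                ≡⟨ ℕ.+-comm (j / k) 1 ⟩
    suc (j / k)              ∎
    where
    open ≡-Reasoning
    suc[j%k]≡k : suc (j % k) ≡ k
    suc[j%k]≡k = ℕ.≤-antisym (m%n<n j k)
      (ℕ∣.∣⇒≤ (ℕ∣.∣m+n∣m⇒∣n (subst (k ∣_) suc-j≡ k∣suc-j) (ℕ∣.n∣m*n (j / k))))

  suc-/-∤ : ¬ k ∣ suc j → suc j / k ≡ j / k
  suc-/-∤ k∤suc-j =
    trans suc-/ (trans (cong (_+_ (j / k)) (m<n⇒m/n≡0 suc[j%k]<k)) (ℕ.+-identityʳ _))
    where
    suc[j%k]≢k : suc (j % k) ≢ k
    suc[j%k]≢k eq = k∤suc-j (subst (k ∣_) (sym (trans suc-j≡ (cong (_+_ (j / k * k)) eq)))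
                      (ℕ∣.∣m∣n⇒∣m+n (ℕ∣.n∣m*n (j / k)) ℕ∣.∣-refl))
    suc[j%k]<k : suc (j % k) < k
    suc[j%k]<k = ℕ.≤∧≢⇒< (m%n<n j k) suc[j%k]≢k

toℕ-cyc : ∀ k .{{_ : NonZero k}} {i : Fin k} → toℕ i ≡ a % k → toℕ (cyc k i) ≡ suc a % k
toℕ-cyc {a} k {i} toℕ-i≡a%k = begin
  toℕ (cyc k i)            ≡⟨ Fin.toℕ-fromℕ< _ ⟩
  suc (toℕ i) % k          ≡⟨ cong (λ u → suc u % k) toℕ-i≡a%k ⟩
  suc (a % k) % k          ≡⟨ %-distribˡ-+ 1 (a % k) k ⟩
  (1 % k + a % k % k) % k  ≡⟨ cong (λ u → (1 % k + u) % k) (m%n%n≡m%n a k) ⟩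
  (1 % k + a % k) % k      ≡⟨ sym (%-distribˡ-+ 1 a k) ⟩
  suc a % k                ∎
  where open ≡-Reasoning

toℕ-iter-cyc : ∀ k .{{_ : NonZero k}} a → toℕ (iter (cyc k) a (first k)) ≡ a % k
toℕ-iter-cyc k zero    = Fin.toℕ-fromℕ< _
toℕ-iter-cyc k (suc a) = toℕ-cyc k (toℕ-iter-cyc k a)

≡mod-cancelˡ-+-<gcd : a ≡ b mod k → a + c ≡ b + d mod j → c < gcd k j → d < gcd k j → c ≡ d
≡mod-cancelˡ-+-<gcd {k = k} {j = j} a≡b a+c≡b+d c<g d<g = ≡mod⇒≡ c<g d<g
  (≡mod-cancelˡ-+ (≡mod-∣ (gcd[m,n]∣m k j) a≡b) (≡mod-∣ (gcd[m,n]∣n k j) a+c≡b+d))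

injective⇒surjective : ∀ {K} {f : Fin K → Fin K} → Injective _≡_ _≡_ f → ∀ y → ∃ λ x → f x ≡ y
injective⇒surjective {zero}  _     ()
injective⇒surjective {suc K} {f} f-inj y with Fin.any? (λ x → f x Fin.≟ y)
... | yes hit  = hit
... | no  miss = contradiction (Fin.injective⇒≤ f-avoiding-y-injective) (ℕ.n≮n K)
  where
  f≢y : ∀ x → y ≢ f x
  f≢y x y≡fx = miss (x , sym y≡fx)
  f-avoiding-y : Fin (suc K) → Fin K
  f-avoiding-y x = punchOut (f≢y x)
  f-avoiding-y-injective : Injective _≡_ _≡_ f-avoiding-y
  f-avoiding-y-injective {x} {x'} eq = f-inj (Fin.punchOut-injective (f≢y x) (f≢y x') eq)

injective⇒bijective : ∀ {A : Set} {K} {f : Fin K → A} (e : A → Fin K) →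
                      Injective _≡_ _≡_ e → Injective _≡_ _≡_ f → Bijective _≡_ _≡_ f
injective⇒bijective {f = f} e e-inj f-inj = f-inj , surjective
  where
  surjective : Surjective _≡_ _≡_ f
  surjective y with x , efx≡ey ← injective⇒surjective (λ eq → f-inj (e-inj eq)) (e y) =
    x , λ { refl → e-inj efx≡ey }

vertexIndex : ∀ {ℓ m n} → Vertex ℓ m n → Fin (ℓ * m * n)
vertexIndex (a , b , c) = combine (combine a b) c

vertexIndex-injective : ∀ {ℓ m n} → Injective _≡_ _≡_ (vertexIndex {ℓ} {m} {n})
vertexIndex-injective {x = a , b , c} {a' , b' , c'} eq
  with ab≡a'b' , refl ← Fin.combine-injective (combine a b) c (combine a' b') c' eq
  with refl , refl ← Fin.combine-injective a b a' b' ab≡a'b' = refl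

module Enumeration (ℓ m n : ℕ) .{{_ : NonZero ℓ}} .{{_ : NonZero m}} .{{_ : NonZero n}} where
  open Construction ℓ m n

  M : ℕ
  M = lcm ℓ m

  instance
    M-nonZero : NonZero M
    M-nonZero = lcm-nonZero ℓ m

  M∣L : M ∣ L
  M∣L = lcm-least (m∣lcm[m,n] ℓ _) (ℕ∣.∣-trans (m∣lcm[m,n] m n) (n∣lcm[m,n] ℓ _))

  n∣L : n ∣ L
  n∣L = ℕ∣.∣-trans (n∣lcm[m,n] m n) (n∣lcm[m,n] ℓ _)

  L∣n*M : L ∣ n * M
  L∣n*M = lcm-least (ℕ∣.∣-trans (m∣lcm[m,n] ℓ m) (ℕ∣.n∣m*n n))
                    (lcm-least (ℕ∣.∣-trans (n∣lcm[m,n] ℓ m) (ℕ∣.n∣m*n n)) (ℕ∣.m∣m*n M))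

  lam*L≡n*M : lam * L ≡ n * M
  lam*L≡n*M = m/n*n≡m L∣n*M

  instance
    lam-nonZero : NonZero lam
    lam-nonZero = ℕ.m*n≢0⇒m≢0 lam {{subst NonZero (sym lam*L≡n*M) (ℕ.m*n≢0 n M)}}

  lam∣n : lam ∣ n
  lam∣n = ℕ∣.*-cancelʳ-∣ L (subst (_∣ n * L) (sym lam*L≡n*M) (ℕ∣.*-monoʳ-∣ n M∣L))

  lam∣M : lam ∣ M
  lam∣M = ℕ∣.*-cancelʳ-∣ L
    (subst (_∣ M * L) (trans (ℕ.*-comm M n) (sym lam*L≡n*M)) (ℕ∣.*-monoʳ-∣ M n∣L))

  gcd*lam*L≡ℓ*m*n : gcd ℓ m * lam * L ≡ ℓ * m * n
  gcd*lam*L≡ℓ*m*n = begin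
    gcd ℓ m * lam * L     ≡⟨ ℕ.*-assoc (gcd ℓ m) lam L ⟩
    gcd ℓ m * (lam * L)   ≡⟨ cong (gcd ℓ m *_) lam*L≡n*M ⟩
    gcd ℓ m * (n * M)     ≡⟨ ℕ.*-comm (gcd ℓ m) (n * M) ⟩
    n * M * gcd ℓ m       ≡⟨ ℕ.*-assoc n M (gcd ℓ m) ⟩
    n * (M * gcd ℓ m)     ≡⟨ cong (n *_) (trans (ℕ.*-comm M (gcd ℓ m)) (gcd*lcm ℓ m)) ⟩
    n * (ℓ * m)           ≡⟨ ℕ.*-comm n (ℓ * m) ⟩
    ℓ * m * n             ∎
    where open ≡-Reasoning

  -- σ-steps j and τ-steps j count how many of the passages A^(1) → … → A^(j+1)
  -- apply σ, respectively τ, in the recursion colDE.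
  σ-steps : ℕ → ℕ
  σ-steps zero = 0
  σ-steps (suc j) with lam ∣? suc j
  ... | yes _ = suc (σ-steps j)
  ... | no  _ = σ-steps j

  τ-steps : ℕ → ℕ
  τ-steps zero = 0
  τ-steps (suc j) with lam ∣? suc j
  ... | yes _ = τ-steps j
  ... | no  _ = suc (τ-steps j)

  σ-steps≡/lam : ∀ j → σ-steps j ≡ j / lam
  σ-steps≡/lam zero = sym (0/n≡0 lam)
  σ-steps≡/lam (suc j) with lam ∣? suc j
  ... | yes lam∣suc-j = trans (cong suc (σ-steps≡/lam j)) (sym (suc-/-∣ j lam lam∣suc-j))
  ... | no  lam∤suc-j = trans (σ-steps≡/lam j) (sym (suc-/-∤ j lam lam∤suc-j))

  σ-steps+τ-steps≡ : ∀ j → σ-steps j + τ-steps j ≡ j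
  σ-steps+τ-steps≡ zero = refl
  σ-steps+τ-steps≡ (suc j) with lam ∣? suc j
  ... | yes _ = cong suc (σ-steps+τ-steps≡ j)
  ... | no  _ = trans (ℕ.+-suc (σ-steps j) (τ-steps j)) (cong suc (σ-steps+τ-steps≡ j))

  toℕ-colD : ∀ j r → toℕ (proj₁ (colDE (suc j)) r) ≡ (r + σ-steps j) % m
  toℕ-colD zero    r = trans (toℕ-iter-cyc m r) (cong (_% m) (sym (ℕ.+-identityʳ r)))
  toℕ-colD (suc j) r with colDE (suc j) | toℕ-colD j | lam ∣? suc j
  ... | _ , _ | ih | yes _ = trans (toℕ-cyc m (ih r)) (cong (_% m) (sym (ℕ.+-suc r (σ-steps j))))
  ... | _ , _ | ih | no  _ = ih r

  toℕ-colE : ∀ j r → toℕ (proj₂ (colDE (suc j)) r) ≡ (r + τ-steps j) % n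
  toℕ-colE zero    r = trans (toℕ-iter-cyc n r) (cong (_% n) (sym (ℕ.+-identityʳ r)))
  toℕ-colE (suc j) r with colDE (suc j) | toℕ-colE j | lam ∣? suc j
  ... | _ , _ | ih | yes _ = ih r
  ... | _ , _ | ih | no  _ = trans (toℕ-cyc n (ih r)) (cong (_% n) (sym (ℕ.+-suc r (τ-steps j))))

  toℕ³ : Vertex ℓ m n → ℕ × ℕ × ℕ
  toℕ³ (a , b , c) = toℕ a , toℕ b , toℕ c

  toℕ³-row : ∀ j r → toℕ³ (row (suc j) r) ≡ (r % ℓ , (r + σ-steps j) % m , (r + τ-steps j) % n)
  toℕ³-row j r with colDE (suc j) | toℕ-colD j r | toℕ-colE j r
  ... | _ , _ | toℕ-d | toℕ-e = cong₂ _,_ (toℕ-iter-cyc ℓ r) (cong₂ _,_ toℕ-d toℕ-e)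

  row-injective : ∀ {r r' j j'} → r < L → r' < L → j < gcd ℓ m * lam → j' < gcd ℓ m * lam →
                  row (suc j) r ≡ row (suc j') r' → r ≡ r' × j ≡ j'
  row-injective {r} {r'} {j} {j'} r<L r'<L j<gλ j'<gλ row≡row' = r≡r' , j≡j'
    where
    coordinates : (r % ℓ , (r + σ-steps j) % m , (r + τ-steps j) % n)
                ≡ (r' % ℓ , (r' + σ-steps j') % m , (r' + τ-steps j') % n)
    coordinates = trans (sym (toℕ³-row j r)) (trans (cong toℕ³ row≡row') (toℕ³-row j' r'))
    r≡r'[ℓ] : r ≡ r' mod ℓ
    r≡r'[ℓ] = %≡%⇒≡mod r r' ℓ (cong proj₁ coordinates)
    r+s≡r'+s'[m] : r + σ-steps j ≡ r' + σ-steps j' mod m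
    r+s≡r'+s'[m] = %≡%⇒≡mod (r + σ-steps j) (r' + σ-steps j') m
                     (cong (λ v → proj₁ (proj₂ v)) coordinates)
    r+t≡r'+t'[n] : r + τ-steps j ≡ r' + τ-steps j' mod n
    r+t≡r'+t'[n] = %≡%⇒≡mod (r + τ-steps j) (r' + τ-steps j') n
                     (cong (λ v → proj₂ (proj₂ v)) coordinates)
    σ-steps<gcd : ∀ {i} → i < gcd ℓ m * lam → σ-steps i < gcd ℓ m
    σ-steps<gcd {i} i<gλ = subst (_< gcd ℓ m) (sym (σ-steps≡/lam i)) (m<n*o⇒m/o<n i<gλ)
    s≡s' : σ-steps j ≡ σ-steps j'
    s≡s' = ≡mod-cancelˡ-+-<gcd r≡r'[ℓ] r+s≡r'+s'[m] (σ-steps<gcd j<gλ) (σ-steps<gcd j'<gλ)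
    r≡r'[m] : r ≡ r' mod m
    r≡r'[m] = ≡mod-cancelʳ-+ (≡⇒≡mod s≡s') r+s≡r'+s'[m]
    r≡r'[lam] : r ≡ r' mod lam
    r≡r'[lam] = ≡mod-∣ lam∣M (≡mod-lcm r≡r'[ℓ] r≡r'[m])
    t≡t'[lam] : τ-steps j ≡ τ-steps j' mod lam
    t≡t'[lam] = ≡mod-cancelˡ-+ r≡r'[lam] (≡mod-∣ lam∣n r+t≡r'+t'[n])
    j≡j'[lam] : j ≡ j' mod lam
    j≡j'[lam] = subst₂ (λ u v → u ≡ v mod lam) (σ-steps+τ-steps≡ j) (σ-steps+τ-steps≡ j')
                  (≡mod-+ (≡⇒≡mod s≡s') t≡t'[lam])
    j≡j' : j ≡ j'
    j≡j' = ≡mod∧/≡/⇒≡ j j' lam j≡j'[lam]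
             (trans (sym (σ-steps≡/lam j)) (trans s≡s' (σ-steps≡/lam j')))
    r≡r'[n] : r ≡ r' mod n
    r≡r'[n] = ≡mod-cancelʳ-+ (≡⇒≡mod (cong τ-steps j≡j')) r+t≡r'+t'[n]
    r≡r' : r ≡ r'
    r≡r' = ≡mod⇒≡ r<L r'<L (≡mod-lcm r≡r'[ℓ] (≡mod-lcm r≡r'[m] r≡r'[n]))

  /L<gcd*lam : ∀ {h} → h < ℓ * m * n → h / L < gcd ℓ m * lam
  /L<gcd*lam {h} h<ℓmn = m<n*o⇒m/o<n (subst (h <_) (sym gcd*lam*L≡ℓ*m*n) h<ℓmn)

  x-injective : ∀ {h h'} → h < ℓ * m * n → h' < ℓ * m * n → x h ≡ x h' → h ≡ h'
  x-injective {h} {h'} h<ℓmn h'<ℓmn xh≡xh' =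
    ≡mod∧/≡/⇒≡ h h' L (%≡%⇒≡mod h h' L (proj₁ same-row-and-matrix)) (proj₂ same-row-and-matrix)
    where
    same-row-and-matrix : h % L ≡ h' % L × h / L ≡ h' / L
    same-row-and-matrix = row-injective (m%n<n h L) (m%n<n h' L)
                            (/L<gcd*lam h<ℓmn) (/L<gcd*lam h'<ℓmn) xh≡xh'

  xs-injective : Injective _≡_ _≡_ (xs ℓ m n)
  xs-injective {i} {i'} eq = Fin.toℕ-injective (x-injective (Fin.toℕ<n i) (Fin.toℕ<n i') eq)

mainTheorem10 : (ℓ m n : ℕ) .{{_ : NonZero ℓ}} .{{_ : NonZero m}} .{{_ : NonZero n}} →
    2 ≤ ℓ → 2 ≤ m → 2 ≤ n →
    Bijective _≡_ _≡_ (xs ℓ m n)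
mainTheorem10 ℓ m n _ _ _ =
  injective⇒bijective vertexIndex vertexIndex-injective (Enumeration.xs-injective ℓ m n)
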